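{- Let $G$ be a finite group generated by an involution $x$ and an element $y$ of order $3$, and suppose that $G\not\cong\mathbb{Z}_6$ and $G\not\cong \mathbb{Z}_3\wr\mathbb{Z}_2$. If $G$ has a subgroup $H$ of index $2$, then there is a Cayley digraph $\Gamma$ on $G$ with Cayley index $2$ such that $\mathrm{Aut}(\Gamma)$ contains a regular subgroup distinct from (the right regular representation of) $G$ and isomorphic to $H\times\mathbb{Z}_2$.
   Context: A digraph has vertex set and arc set consisting of ordered pairs of distinct vertices (no loops); $\mathrm{Aut}(\Gamma)$ is the group of permutations of the vertices preserving arcs. For a group $G$ and $S\subseteq G$ not containing the identity, the Cayley digraph $\mathrm{Cay}(G,S)$ has vertex set $G$ and arcs $(u,v)$ whenever $vu^{ -1}\in S$. $G$ embeds in $\mathrm{Aut}(\mathrm{Cay}(G,S))$ via its right regular representation, and the Cayley index is $|\mathrm{Aut}(\mathrm{Cay}(G,S)):G|$. A subgroup of $\mathrm{Aut}(\Gamma)$ is regular if it acts regularly on the vertex set. -}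

module Defs where

open import Data.Nat using (ℕ; zero; suc; _*_; _+_; _<_; NonZero)
open import Data.Fin using (Fin; toℕ; fromℕ<)
open import Data.Fin.Subset using (Subset; _∈_; _∉_; ∣_∣)
open import Data.Fin.Permutation using (Permutation′; _⟨$⟩ʳ_)
open import Data.Product using (Σ; ∃; _×_; _,_; proj₁; proj₂)
open import Data.Nat.DivMod using (_mod_)
open import Relation.Binary.PropositionalEquality using (_≡_; _≢_)
open import Relation.Nullary using (¬_)
open import Algebra.Structures using (IsGroup)
open import Level using (0ℓ)

-- Finite groups, concretely: carrier Fin n, equality is ≡.
-- (Every finite group is isomorphic to one of this form.)

addMod : (k : ℕ) → .{{_ : NonZero k}} → Fin k → Fin k → Fin k
addMod k a b = (toℕ a + toℕ b) mod k

record FinGroup (n : ℕ) : Set where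
  infixl 7 _∙_
  field
    _∙_     : Fin n → Fin n → Fin n
    ε       : Fin n
    _⁻¹     : Fin n → Fin n
    isGroup : IsGroup _≡_ _∙_ ε _⁻¹

module _ {n : ℕ} (G : FinGroup n) where
  open FinGroup G

  pow : Fin n → ℕ → Fin n
  pow g zero    = ε
  pow g (suc k) = g ∙ pow g k

  HasOrder : Fin n → ℕ → Set
  HasOrder g k = pow g k ≡ ε × (∀ j → 0 < j → j < k → pow g j ≢ ε)

  Generates : Fin n → Fin n → Set₁
  Generates x y =
    (K : Fin n → Set) → K ε → (∀ a b → K a → K b → K (a ∙ b)) →
    (∀ a → K a → K (a ⁻¹)) → K x → K y → ∀ g → K g

  IsoTo : (T : Set) → (T → T → T) → Set
  IsoTo T _⋆_ = Σ (Fin n → T) λ φ →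
    (∀ a b → φ a ≡ φ b → a ≡ b) × (∀ t → ∃ λ a → φ a ≡ t) ×
    (∀ a b → φ (a ∙ b) ≡ φ a ⋆ φ b)

  record IsSubgroup (H : Subset n) : Set where
    field
      ε∈   : ε ∈ H
      ∙∈   : ∀ {a b} → a ∈ H → b ∈ H → (a ∙ b) ∈ H
      ⁻¹∈  : ∀ {a} → a ∈ H → (a ⁻¹) ∈ H

  HasIndex : Subset n → ℕ → Set
  HasIndex H k = n ≡ k * ∣ H ∣

  Arc : Subset n → Fin n → Fin n → Set
  Arc S u v = (v ∙ (u ⁻¹)) ∈ S

  IsAut : Subset n → Permutation′ n → Set
  IsAut S π = ∀ u v →
    (Arc S u v → Arc S (π ⟨$⟩ʳ u) (π ⟨$⟩ʳ v)) ×
    (Arc S (π ⟨$⟩ʳ u) (π ⟨$⟩ʳ v) → Arc S u v)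

  -- |Aut(Cay(G,S))| = m : an explicit enumeration of the automorphisms
  -- without repetition (permutations compared pointwise)
  AutOrder : Subset n → ℕ → Set
  AutOrder S m = Σ (Fin m → Permutation′ n) λ f →
    (∀ i → IsAut S (f i)) ×
    (∀ i j → (∀ u → f i ⟨$⟩ʳ u ≡ f j ⟨$⟩ʳ u) → i ≡ j) ×
    (∀ π → IsAut S π → ∃ λ i → ∀ u → π ⟨$⟩ʳ u ≡ f i ⟨$⟩ʳ u)

  CayleyIndex : Subset n → ℕ → Set
  CayleyIndex S k = AutOrder S (k * n)

  HZ2 : Subset n → Set
  HZ2 H = Σ (Fin n) (λ g → g ∈ H) × Fin 2

  HZ2-mul : (H : Subset n) → IsSubgroup H → HZ2 H → HZ2 H → HZ2 H
  HZ2-mul H sg ((a , a∈) , s) ((b , b∈) , t) =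
    (a ∙ b , IsSubgroup.∙∈ sg a∈ b∈) , addMod 2 s t

  -- Aut(Cay(G,S)) contains a regular subgroup isomorphic to H × Z₂,
  -- distinct from the right regular representation of G.  The subgroup
  -- is given as the image of a faithful right action ρ of H × Z₂
  -- (ρ (a b) = ρ a followed by ρ b) by automorphisms.
  RegularHZ2 : (S H : Subset n) → IsSubgroup H → Set
  RegularHZ2 S H sg = Σ (HZ2 H → Permutation′ n) λ ρ →
    (∀ a b u → ρ (HZ2-mul H sg a b) ⟨$⟩ʳ u ≡ ρ b ⟨$⟩ʳ (ρ a ⟨$⟩ʳ u)) ×
    (∀ a → IsAut S (ρ a)) ×
    (∀ u v → ∃ λ a → ρ a ⟨$⟩ʳ u ≡ v) ×
    (∀ a b u → ρ a ⟨$⟩ʳ u ≡ ρ b ⟨$⟩ʳ u → a ≡ b) ×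
    ¬ ( (∀ a → ∃ λ g → ∀ u → ρ a ⟨$⟩ʳ u ≡ u ∙ g)
      × (∀ g → ∃ λ a → ∀ u → ρ a ⟨$⟩ʳ u ≡ u ∙ g))

Z6 : Set
Z6 = Fin 6

Z6-mul : Z6 → Z6 → Z6
Z6-mul = addMod 6

-- ℤ₃ ≀ ℤ₂ = (ℤ₃ × ℤ₃) ⋊ ℤ₂, the generator of ℤ₂ swapping coordinates
Z3wrZ2 : Set
Z3wrZ2 = (Fin 3 × Fin 3) × Fin 2

act : Fin 2 → Fin 3 × Fin 3 → Fin 3 × Fin 3
act Fin.zero    v       = v
act (Fin.suc _) (p , q) = q , p

Z3wrZ2-mul : Z3wrZ2 → Z3wrZ2 → Z3wrZ2
Z3wrZ2-mul ((a , b) , s) (w , t) with act s w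
... | (c , d) = (addMod 3 a c , addMod 3 b d) , addMod 2 s t

-- Since G ≇ ℤ₆, x and y do not commute; take S = {x, y, z} with z = xyx.
-- In Cay(G, S) every y- and z-arc lies on a directed triangle while no x-arc
-- does, so an automorphism φ fixing 1 satisfies φ(xu) = x φ(u).  At each
-- vertex φ then either preserves or swaps the y- and z-arcs, and this choice
-- is the same at u, xu and yu, hence everywhere; so φ is the identity or
-- conjugation by x.  Thus Aut(Cay(G, S)) = {u ↦ xᵉ u xᵉ g}, of order 2|G|.
-- An index-2 subgroup H is normal and contains y (it has odd order), so
-- x ∉ H, and the maps u ↦ xᵉ u h (h ∈ H) form a regular subgroup isomorphic
-- to H × ℤ₂; it is not G acting on the right because xy ≠ yx.

module Submission where

open import Defs
open import Algebra.Bundles using (Group; Monoid)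
open import Algebra.Structures using (IsGroup)
import Algebra.Properties.Group as GroupProperties
open import Data.Bool using (true; false; if_then_else_)
open import Data.Empty using (⊥; ⊥-elim)
open import Data.Fin as Fin using (Fin; toℕ; #_)
open import Data.Fin.Permutation using (Permutation′; _⟨$⟩ʳ_; _⟨$⟩ˡ_; permutation; _∘ₚ_)
import Data.Fin.Permutation as Permutation
open import Data.Fin.Properties using (toℕ-fromℕ<; toℕ-injective; toℕ<n; remQuot-combine; combine-remQuot)
open import Data.Fin.Subset using (Subset; _∈_; _∉_; ∣_∣; ⁅_⁆; _∪_; ⊤)
open import Data.Fin.Subset.Properties
  using (_∈?_; x∈⁅x⁆; x∈⁅y⁆⇒x≡y; x∈p∪q⁺; x∈p∪q⁻; ∣⊤∣≡n; ∣⁅x⁆∣≡1; p⊆q⇒∣p∣≤∣q∣)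
open import Data.Nat as ℕ using (ℕ; zero; suc; _+_; _*_; _∸_; _≤_; _<_; z≤n; s≤s; z<s; NonZero)
open import Data.Nat.DivMod using (_%_; _/_; m≡m%n+[m/n]*n; m%n<n)
import Data.Nat.Properties as ℕ
open import Data.Product using (Σ; ∃; _×_; _,_; proj₁; proj₂; uncurry)
open import Data.Sum using (_⊎_; inj₁; inj₂)
open import Data.Vec using (lookup; _∷_; [])
open import Data.Vec.Properties using ([]=⇒lookup; lookup⇒[]=)
open import Data.Vec.Properties.WithK using ([]=-irrelevant)
open import Level using (0ℓ)
open import Function using (_∘_)
open import Relation.Binary.PropositionalEquality
open import Relation.Nullary using (¬_; yes; no)
open import Relation.Binary.Definitions using (tri<; tri≈; tri>)
open import Tactic.MonoidSolver using (solve)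
open import Algebra.Properties.CommutativeMonoid.Sum ℕ.+-0-commutativeMonoid
  using (sum; ∑-distrib-+; sum-permute; sum-cong-≗)

open ≡-Reasoning

-- Sums of indicator functions

indicator : ∀ {m} → Subset m → Fin m → ℕ
indicator p i = if lookup p i then 1 else 0

∣p∣≡sum-indicator : ∀ {m} (p : Subset m) → ∣ p ∣ ≡ sum (indicator p)
∣p∣≡sum-indicator []          = refl
∣p∣≡sum-indicator (true ∷ p)  = cong suc (∣p∣≡sum-indicator p)
∣p∣≡sum-indicator (false ∷ p) = ∣p∣≡sum-indicator p

indicator-∈ : ∀ {m} {p : Subset m} {i} → i ∈ p → indicator p i ≡ 1
indicator-∈ i∈p rewrite []=⇒lookup i∈p = refl

indicator-∉ : ∀ {m} {p : Subset m} {i} → i ∉ p → indicator p i ≡ 0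
indicator-∉ {p = p} {i} i∉p with lookup p i in eq
... | true  = ⊥-elim (i∉p (lookup⇒[]= i p eq))
... | false = refl

indicator≤1 : ∀ {m} (p : Subset m) i → indicator p i ≤ 1
indicator≤1 p i with lookup p i
... | true  = ℕ.≤-refl
... | false = z≤n

sum-mono-≤ : ∀ {m} {f g : Fin m → ℕ} → (∀ i → f i ≤ g i) → sum f ≤ sum g
sum-mono-≤ {zero}  f≤g = z≤n
sum-mono-≤ {suc m} f≤g = ℕ.+-mono-≤ (f≤g Fin.zero) (sum-mono-≤ (λ i → f≤g (Fin.suc i)))

sum-const-1 : ∀ m → sum {m} (λ _ → 1) ≡ m
sum-const-1 zero    = refl
sum-const-1 (suc m) = cong suc (sum-const-1 m)

module GroupFacts {n : ℕ} (G : FinGroup n) where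
  open FinGroup G public
  open IsGroup isGroup public using (assoc; identityˡ; identityʳ; inverseˡ; inverseʳ)

  group : Group 0ℓ 0ℓ
  group = record { isGroup = isGroup }

  monoid : Monoid 0ℓ 0ℓ
  monoid = Group.monoid group

  open GroupProperties group public
    using (∙-cancelˡ; ∙-cancelʳ; inverseˡ-unique; identityˡ-unique; ⁻¹-anti-homo-∙; ⁻¹-involutive)

  a∙[a⁻¹∙b]≡b : ∀ a b → a ∙ (a ⁻¹ ∙ b) ≡ b
  a∙[a⁻¹∙b]≡b a b = trans (sym (assoc a _ b)) (trans (cong (_∙ b) (inverseʳ a)) (identityˡ b))

  a⁻¹∙[a∙b]≡b : ∀ a b → a ⁻¹ ∙ (a ∙ b) ≡ b
  a⁻¹∙[a∙b]≡b a b = trans (sym (assoc _ a b)) (trans (cong (_∙ b) (inverseˡ a)) (identityˡ b))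

  [a∙b]∙b⁻¹≡a : ∀ a b → (a ∙ b) ∙ b ⁻¹ ≡ a
  [a∙b]∙b⁻¹≡a a b = trans (assoc a b _) (trans (cong (a ∙_) (inverseʳ b)) (identityʳ a))

  [a∙b⁻¹]∙b≡a : ∀ a b → (a ∙ b ⁻¹) ∙ b ≡ a
  [a∙b⁻¹]∙b≡a a b = trans (assoc a _ b) (trans (cong (a ∙_) (inverseˡ b)) (identityʳ a))

  [a∙k]∙[b∙k]⁻¹≡a∙b⁻¹ : ∀ a b k → (a ∙ k) ∙ (b ∙ k) ⁻¹ ≡ a ∙ b ⁻¹
  [a∙k]∙[b∙k]⁻¹≡a∙b⁻¹ a b k = begin
    (a ∙ k) ∙ (b ∙ k) ⁻¹      ≡⟨ cong ((a ∙ k) ∙_) (⁻¹-anti-homo-∙ b k) ⟩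
    (a ∙ k) ∙ (k ⁻¹ ∙ b ⁻¹)   ≡⟨ solve monoid ⟩
    a ∙ ((k ∙ k ⁻¹) ∙ b ⁻¹)   ≡⟨ cong (λ e → a ∙ (e ∙ b ⁻¹)) (inverseʳ k) ⟩
    a ∙ (ε ∙ b ⁻¹)            ≡⟨ cong (a ∙_) (identityˡ _) ⟩
    a ∙ b ⁻¹                  ∎

  involution-⁻¹ : ∀ {c} → c ∙ c ≡ ε → c ⁻¹ ≡ c
  involution-⁻¹ {c} cc≡ε = sym (inverseˡ-unique c c cc≡ε)

  involution-cancel : ∀ {c} → c ∙ c ≡ ε → ∀ a → c ∙ (c ∙ a) ≡ a
  involution-cancel {c} cc≡ε a = trans (sym (assoc c c a)) (trans (cong (_∙ a) cc≡ε) (identityˡ a))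

  involution-conj-involutive : ∀ {c} → c ∙ c ≡ ε → ∀ a → (c ∙ ((c ∙ a) ∙ c)) ∙ c ≡ a
  involution-conj-involutive {c} cc≡ε a = begin
    (c ∙ ((c ∙ a) ∙ c)) ∙ c   ≡⟨ solve monoid ⟩
    c ∙ (c ∙ (a ∙ (c ∙ c)))   ≡⟨ involution-cancel cc≡ε _ ⟩
    a ∙ (c ∙ c)               ≡⟨ cong (a ∙_) cc≡ε ⟩
    a ∙ ε                     ≡⟨ identityʳ a ⟩
    a                         ∎

  translation : Fin n → Fin n → Permutation′ n
  translation c k = permutation (λ u → (c ∙ u) ∙ k) (λ v → c ⁻¹ ∙ (v ∙ k ⁻¹))
    (λ v → trans (cong (_∙ k) (a∙[a⁻¹∙b]≡b c _)) ([a∙b⁻¹]∙b≡a v k))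
    (λ u → trans (cong (c ⁻¹ ∙_) ([a∙b]∙b⁻¹≡a _ k)) (a⁻¹∙[a∙b]≡b c u))

  pow-+ : ∀ g i j → pow G g (i + j) ≡ pow G g i ∙ pow G g j
  pow-+ g zero    j = sym (identityˡ _)
  pow-+ g (suc i) j = trans (cong (g ∙_) (pow-+ g i j)) (sym (assoc g _ _))

  pow-*-ε : ∀ {g d} → pow G g d ≡ ε → ∀ q → pow G g (q * d) ≡ ε
  pow-*-ε         gᵈ≡ε zero    = refl
  pow-*-ε {g} {d} gᵈ≡ε (suc q) = begin
    pow G g (d + q * d)           ≡⟨ pow-+ g d (q * d) ⟩
    pow G g d ∙ pow G g (q * d)   ≡⟨ cong₂ _∙_ gᵈ≡ε (pow-*-ε gᵈ≡ε q) ⟩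
    ε ∙ ε                         ≡⟨ identityˡ ε ⟩
    ε                             ∎

  commutesWithGenerators⇒rightTranslation : ∀ {x y} → Generates G x y →
    (f : Fin n → Fin n) → (∀ u → f (x ∙ u) ≡ x ∙ f u) → (∀ u → f (y ∙ u) ≡ y ∙ f u) →
    ∀ g → f g ≡ g ∙ f ε
  commutesWithGenerators⇒rightTranslation gen f fx fy g =
    trans (cong f (sym (identityʳ g))) (commutes g ε)
    where
    Commutes : Fin n → Set
    Commutes h = ∀ u → f (h ∙ u) ≡ h ∙ f u
    commutes : ∀ h → Commutes h
    commutes = gen Commutes
      (λ u → trans (cong f (identityˡ u)) (sym (identityˡ (f u))))
      (λ a b ca cb u → begin
        f ((a ∙ b) ∙ u)  ≡⟨ cong f (assoc a b u) ⟩
        f (a ∙ (b ∙ u))  ≡⟨ ca _ ⟩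
        a ∙ f (b ∙ u)    ≡⟨ cong (a ∙_) (cb u) ⟩
        a ∙ (b ∙ f u)    ≡⟨ sym (assoc a b _) ⟩
        (a ∙ b) ∙ f u    ∎)
      (λ a ca u → begin
        f (a ⁻¹ ∙ u)                ≡⟨ sym (a⁻¹∙[a∙b]≡b a _) ⟩
        a ⁻¹ ∙ (a ∙ f (a ⁻¹ ∙ u))   ≡⟨ cong (a ⁻¹ ∙_) (sym (ca _)) ⟩
        a ⁻¹ ∙ f (a ∙ (a ⁻¹ ∙ u))   ≡⟨ cong (λ v → a ⁻¹ ∙ f v) (a∙[a⁻¹∙b]≡b a u) ⟩
        a ⁻¹ ∙ f u                  ∎)
      fx fy

  leftInvariant⇒constant : ∀ {x y} → Generates G x y → (P : Fin n → Set) →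
    (∀ u → (P u → P (x ∙ u)) × (P (x ∙ u) → P u)) →
    (∀ u → (P u → P (y ∙ u)) × (P (y ∙ u) → P u)) →
    ∀ g → (P ε → P g) × (P g → P ε)
  leftInvariant⇒constant gen P Px Py g =
    subst P (identityʳ g) ∘ proj₁ (invariant g ε) , proj₂ (invariant g ε) ∘ subst P (sym (identityʳ g))
    where
    Invariant : Fin n → Set
    Invariant h = ∀ u → (P u → P (h ∙ u)) × (P (h ∙ u) → P u)
    invariant : ∀ h → Invariant h
    invariant = gen Invariant
      (λ u → subst P (sym (identityˡ u)) , subst P (identityˡ u))
      (λ a b ia ib u →
        (λ p → subst P (sym (assoc a b u)) (proj₁ (ia _) (proj₁ (ib u) p))) ,
        (λ p → proj₂ (ib u) (proj₂ (ia _) (subst P (assoc a b u) p))))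
      (λ a ia u →
        (λ p → proj₂ (ia (a ⁻¹ ∙ u)) (subst P (sym (a∙[a⁻¹∙b]≡b a u)) p)) ,
        (λ p → subst P (a∙[a⁻¹∙b]≡b a u) (proj₁ (ia (a ⁻¹ ∙ u)) p)))
      Px Py

-- Isomorphisms and cyclic groups

module _ {n : ℕ} (G : FinGroup n) where
  open GroupFacts G

  IsoTo-fromInverse : {T : Set} {_⋆_ : T → T → T} (ψ : T → Fin n) →
    (∀ s t → ψ s ≡ ψ t → s ≡ t) → (∀ g → ∃ λ t → ψ t ≡ g) →
    (∀ s t → ψ (s ⋆ t) ≡ ψ s ∙ ψ t) → IsoTo G T _⋆_
  IsoTo-fromInverse {_⋆_ = _⋆_} ψ ψ-inj ψ-surj ψ-hom =
    φ , φ-inj , (λ t → ψ t , ψ-inj _ _ (ψ∘φ (ψ t))) , φ-hom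
    where
    φ : Fin n → _
    φ g = proj₁ (ψ-surj g)
    ψ∘φ : ∀ g → ψ (φ g) ≡ g
    ψ∘φ g = proj₂ (ψ-surj g)
    φ-inj : ∀ a b → φ a ≡ φ b → a ≡ b
    φ-inj a b e = trans (sym (ψ∘φ a)) (trans (cong ψ e) (ψ∘φ b))
    φ-hom : ∀ a b → φ (a ∙ b) ≡ φ a ⋆ φ b
    φ-hom a b = ψ-inj _ _ (begin
      ψ (φ (a ∙ b))         ≡⟨ ψ∘φ (a ∙ b) ⟩
      a ∙ b                 ≡⟨ sym (cong₂ _∙_ (ψ∘φ a) (ψ∘φ b)) ⟩
      ψ (φ a) ∙ ψ (φ b)     ≡⟨ sym (ψ-hom (φ a) (φ b)) ⟩
      ψ (φ a ⋆ φ b)         ∎)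

module Cyclic {n : ℕ} (G : FinGroup n) (g : Fin n) (k : ℕ) .{{_ : NonZero k}}
  (order : HasOrder G g k) where
  open GroupFacts G

  pow-% : ∀ m → pow G g m ≡ pow G g (m % k)
  pow-% m = begin
    pow G g m                                 ≡⟨ cong (pow G g) (m≡m%n+[m/n]*n m k) ⟩
    pow G g (m % k + m / k * k)               ≡⟨ pow-+ g (m % k) _ ⟩
    pow G g (m % k) ∙ pow G g (m / k * k)     ≡⟨ cong (pow G g (m % k) ∙_) (pow-*-ε (proj₁ order) (m / k)) ⟩
    pow G g (m % k) ∙ ε                       ≡⟨ identityʳ _ ⟩
    pow G g (m % k)                           ∎

  power : Fin k → Fin n
  power i = pow G g (toℕ i)

  power-+ : ∀ i j → power (addMod k i j) ≡ power i ∙ power j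
  power-+ i j = begin
    pow G g (toℕ (addMod k i j))      ≡⟨ cong (pow G g) (toℕ-fromℕ< (m%n<n (toℕ i + toℕ j) k)) ⟩
    pow G g ((toℕ i + toℕ j) % k)     ≡⟨ sym (pow-% _) ⟩
    pow G g (toℕ i + toℕ j)           ≡⟨ pow-+ g (toℕ i) (toℕ j) ⟩
    power i ∙ power j                 ∎

  pow-injective-< : ∀ {i j} → i < j → j < k → pow G g i ≢ pow G g j
  pow-injective-< {i} i<j j<k eq with ℕ.m≤n⇒∃[o]m+o≡n i<j
  ... | d , refl = proj₂ order (suc d) z<s (ℕ.≤-<-trans (s≤s (ℕ.m≤n+m d i)) j<k)
    (identityˡ-unique _ (pow G g i) (begin
      pow G g (suc d) ∙ pow G g i   ≡⟨ sym (pow-+ g (suc d) i) ⟩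
      pow G g (suc d + i)           ≡⟨ cong (λ m → pow G g (suc m)) (ℕ.+-comm d i) ⟩
      pow G g (suc i + d)           ≡⟨ sym eq ⟩
      pow G g i                     ∎))

  power-injective : ∀ i j → power i ≡ power j → i ≡ j
  power-injective i j eq with ℕ.<-cmp (toℕ i) (toℕ j)
  ... | tri< i<j _ _ = ⊥-elim (pow-injective-< i<j (toℕ<n j) eq)
  ... | tri≈ _ i≡j _ = toℕ-injective i≡j
  ... | tri> _ _ j<i = ⊥-elim (pow-injective-< j<i (toℕ<n i) (sym eq))

  power-ε : ∃ λ i → power i ≡ ε
  power-ε = Fin.fromℕ< (ℕ.>-nonZero⁻¹ k) , cong (pow G g) (toℕ-fromℕ< (ℕ.>-nonZero⁻¹ k))

  power-⁻¹ : ∀ i → ∃ λ j → power j ≡ power i ⁻¹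
  power-⁻¹ i = j , inverseˡ-unique (power j) (power i) (begin
    power j ∙ power i                     ≡⟨ cong (_∙ power i) (cong (pow G g) (toℕ-fromℕ< (m%n<n (k ∸ toℕ i) k))) ⟩
    pow G g ((k ∸ toℕ i) % k) ∙ power i   ≡⟨ cong (_∙ power i) (sym (pow-% (k ∸ toℕ i))) ⟩
    pow G g (k ∸ toℕ i) ∙ power i         ≡⟨ sym (pow-+ g (k ∸ toℕ i) (toℕ i)) ⟩
    pow G g (k ∸ toℕ i + toℕ i)           ≡⟨ cong (pow G g) (ℕ.m∸n+n≡m (ℕ.<⇒≤ (toℕ<n i))) ⟩
    pow G g k                             ≡⟨ proj₁ order ⟩
    ε                                     ∎)
    where
    j : Fin k
    j = Fin.fromℕ< (m%n<n (k ∸ toℕ i) k)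

  powers-generate : ∀ {a b} → Generates G a b →
    (∃ λ i → power i ≡ a) → (∃ λ i → power i ≡ b) → ∀ h → ∃ λ i → power i ≡ h
  powers-generate gen =
    gen (λ h → ∃ λ i → power i ≡ h) power-ε
      (λ a b (i , ea) (j , eb) → addMod k i j , trans (power-+ i j) (cong₂ _∙_ ea eb))
      (λ a (i , ea) → proj₁ (power-⁻¹ i) , trans (proj₂ (power-⁻¹ i)) (cong _⁻¹ ea))

  cyclic-IsoTo : (∀ h → ∃ λ i → power i ≡ h) → IsoTo G (Fin k) (addMod k)
  cyclic-IsoTo surj = IsoTo-fromInverse G {_⋆_ = addMod k} power power-injective surj power-+

-- Subgroups of index two

module IndexTwo {n : ℕ} (G : FinGroup n) (H : Subset n) (sg : IsSubgroup G H)
  (index : HasIndex G H 2) where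
  open GroupFacts G
  open IsSubgroup sg

  χ : Fin n → ℕ
  χ = indicator H

  sum-χ-translate : ∀ c → sum (λ u → χ (c ∙ u)) ≡ ∣ H ∣
  sum-χ-translate c = begin
    sum (λ u → χ (c ∙ u))          ≡⟨ sum-cong-≗ (λ u → cong χ (sym (identityʳ (c ∙ u)))) ⟩
    sum (λ u → χ ((c ∙ u) ∙ ε))    ≡⟨ sym (sum-permute χ (translation c ε)) ⟩
    sum χ                          ≡⟨ sym (∣p∣≡sum-indicator H) ⟩
    ∣ H ∣                          ∎

  ∣H∣>0 : 0 < ∣ H ∣
  ∣H∣>0 = subst (_≤ ∣ H ∣) (∣⁅x⁆∣≡1 ε)
    (p⊆q⇒∣p∣≤∣q∣ (λ u∈⁅ε⁆ → subst (_∈ H) (sym (x∈⁅y⁆⇒x≡y ε u∈⁅ε⁆)) ε∈))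

  ∈-cancelʳ : ∀ {a k} → a ∙ k ∈ H → k ∈ H → a ∈ H
  ∈-cancelʳ {a} {k} ak∈ k∈ = subst (_∈ H) ([a∙b]∙b⁻¹≡a a k) (∙∈ ak∈ (⁻¹∈ k∈))

  ⁻¹∉ : ∀ {a} → a ∉ H → a ⁻¹ ∉ H
  ⁻¹∉ {a} a∉ a⁻¹∈ = a∉ (subst (_∈ H) (⁻¹-involutive a) (⁻¹∈ a⁻¹∈))

  -- Otherwise H, a⁻¹H and bH would be three disjoint sets of size |H| in G.
  ∉∙∉⇒∈ : ∀ {a b} → a ∉ H → b ∉ H → a ∙ b ∈ H
  ∉∙∉⇒∈ {a} {b} a∉ b∉ with (a ∙ b) ∈? H
  ... | yes ab∈ = ab∈
  ... | no ab∉  = ⊥-elim (ℕ.<⇒≱ ∣H∣>0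
      (ℕ.+-cancelˡ-≤ ∣ H ∣ _ _ (ℕ.+-cancelˡ-≤ ∣ H ∣ _ _ three-cosets)))
    where
    a∙b-from : ∀ k → a ∙ k ∈ H → b ⁻¹ ∙ k ∈ H → a ∙ b ∈ H
    a∙b-from k ak∈ bk∈ = subst (_∈ H) eq (∙∈ ak∈ (⁻¹∈ bk∈))
      where
      eq : (a ∙ k) ∙ (b ⁻¹ ∙ k) ⁻¹ ≡ a ∙ b
      eq = trans ([a∙k]∙[b∙k]⁻¹≡a∙b⁻¹ a (b ⁻¹) k) (cong (a ∙_) (⁻¹-involutive b))
    disjoint : ∀ k → χ k + (χ (a ∙ k) + χ (b ⁻¹ ∙ k)) ≤ 1
    disjoint k with k ∈? H | (a ∙ k) ∈? H
    ... | yes k∈ | _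
      rewrite indicator-∈ k∈ | indicator-∉ (λ ak∈ → a∉ (∈-cancelʳ ak∈ k∈))
            | indicator-∉ (λ bk∈ → ⁻¹∉ b∉ (∈-cancelʳ bk∈ k∈)) = ℕ.≤-refl
    ... | no k∉ | yes ak∈
      rewrite indicator-∉ k∉ | indicator-∈ ak∈ | indicator-∉ (λ bk∈ → ab∉ (a∙b-from k ak∈ bk∈)) = ℕ.≤-refl
    ... | no k∉ | no ak∉
      rewrite indicator-∉ k∉ | indicator-∉ ak∉ = indicator≤1 H _
    three-translates : ∣ H ∣ + (∣ H ∣ + ∣ H ∣) ≡ sum (λ k → χ k + (χ (a ∙ k) + χ (b ⁻¹ ∙ k)))
    three-translates = begin
      ∣ H ∣ + (∣ H ∣ + ∣ H ∣)
        ≡⟨ cong₂ _+_ (∣p∣≡sum-indicator H) (cong₂ _+_ (sym (sum-χ-translate a)) (sym (sum-χ-translate (b ⁻¹)))) ⟩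
      sum χ + (sum (λ k → χ (a ∙ k)) + sum (λ k → χ (b ⁻¹ ∙ k)))
        ≡⟨ cong (sum χ +_) (sym (∑-distrib-+ (λ k → χ (a ∙ k)) (λ k → χ (b ⁻¹ ∙ k)))) ⟩
      sum χ + sum (λ k → χ (a ∙ k) + χ (b ⁻¹ ∙ k))
        ≡⟨ sym (∑-distrib-+ χ _) ⟩
      sum (λ k → χ k + (χ (a ∙ k) + χ (b ⁻¹ ∙ k)))   ∎
    three-cosets : ∣ H ∣ + (∣ H ∣ + ∣ H ∣) ≤ ∣ H ∣ + (∣ H ∣ + 0)
    three-cosets = subst₂ _≤_ (sym three-translates) (trans (sum-const-1 n) index)
      (sum-mono-≤ {g = λ _ → 1} disjoint)

  conj-∈ : ∀ {h} u → h ∈ H → (u ∙ h) ∙ u ⁻¹ ∈ H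
  conj-∈ {h} u h∈ with u ∈? H
  ... | yes u∈ = ∙∈ (∙∈ u∈ h∈) (⁻¹∈ u∈)
  ... | no u∉  = ∉∙∉⇒∈ (λ uh∈ → u∉ (∈-cancelʳ uh∈ h∈)) (⁻¹∉ u∉)

  cube≡ε⇒∈ : ∀ {y} → y ∙ (y ∙ y) ≡ ε → y ∈ H
  cube≡ε⇒∈ {y} yyy≡ε with y ∈? H
  ... | yes y∈ = y∈
  ... | no y∉  = subst (_∈ H) (sym (inverseˡ-unique y _ yyy≡ε)) (⁻¹∈ (∉∙∉⇒∈ y∉ y∉))

  generator∉ : ∀ {x y} → Generates G x y → y ∈ H → x ∉ H
  generator∉ {x} gen y∈ x∈ = ℕ.<⇒≱ ∣H∣>0 (ℕ.+-cancelˡ-≤ ∣ H ∣ _ _ 2∣H∣≤∣H∣)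
    where
    2∣H∣≤∣H∣ : ∣ H ∣ + ∣ H ∣ ≤ ∣ H ∣ + 0
    2∣H∣≤∣H∣ = subst₂ _≤_ (trans (∣⊤∣≡n n) (trans index (cong (∣ H ∣ +_) (ℕ.+-identityʳ _))))
      (sym (ℕ.+-identityʳ _))
      (p⊆q⇒∣p∣≤∣q∣ {p = ⊤} (λ {u} _ → gen (_∈ H) ε∈ (λ _ _ → ∙∈) (λ _ → ⁻¹∈) x∈ y∈ u))

-- Automorphisms of Cayley digraphs induced by u ↦ c u k

module _ {n : ℕ} (G : FinGroup n) where
  open GroupFacts G

  involution-translation-isAut : ∀ (S : Subset n) {c} k → c ∙ c ≡ ε →
    (∀ {g} → g ∈ S → (c ∙ g) ∙ c ∈ S) → IsAut G S (translation c k)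
  involution-translation-isAut S {c} k cc≡ε conj∈ u v =
    (λ arc → subst (_∈ S) (sym arc-image) (conj∈ arc)) ,
    (λ arc → subst (_∈ S) (involution-conj-involutive cc≡ε _) (conj∈ (subst (_∈ S) arc-image arc)))
    where
    arc-image : ((c ∙ v) ∙ k) ∙ ((c ∙ u) ∙ k) ⁻¹ ≡ (c ∙ (v ∙ u ⁻¹)) ∙ c
    arc-image = begin
      ((c ∙ v) ∙ k) ∙ ((c ∙ u) ∙ k) ⁻¹   ≡⟨ [a∙k]∙[b∙k]⁻¹≡a∙b⁻¹ _ _ k ⟩
      (c ∙ v) ∙ (c ∙ u) ⁻¹               ≡⟨ cong ((c ∙ v) ∙_) (⁻¹-anti-homo-∙ c u) ⟩
      (c ∙ v) ∙ (u ⁻¹ ∙ c ⁻¹)            ≡⟨ cong (λ d → (c ∙ v) ∙ (u ⁻¹ ∙ d)) (involution-⁻¹ cc≡ε) ⟩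
      (c ∙ v) ∙ (u ⁻¹ ∙ c)               ≡⟨ solve monoid ⟩
      (c ∙ (v ∙ u ⁻¹)) ∙ c               ∎

  IsAut-∘ₚ : ∀ S {π σ} → IsAut G S π → IsAut G S σ → IsAut G S (π ∘ₚ σ)
  IsAut-∘ₚ S π-aut σ-aut u v =
    (λ arc → proj₁ (σ-aut _ _) (proj₁ (π-aut u v) arc)) ,
    (λ arc → proj₂ (π-aut u v) (proj₂ (σ-aut _ _) arc))

-- A group generated by an involution x and an element y of order 3

module Generators {n : ℕ} (G : FinGroup n) (x y : Fin n)
  (x-order : HasOrder G x 2) (y-order : HasOrder G y 3) (gen : Generates G x y) where
  open GroupFacts G

  x∙x≡ε : x ∙ x ≡ ε
  x∙x≡ε = trans (cong (x ∙_) (sym (identityʳ x))) (proj₁ x-order)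

  y∙[y∙y]≡ε : y ∙ (y ∙ y) ≡ ε
  y∙[y∙y]≡ε = trans (cong (λ a → y ∙ (y ∙ a)) (sym (identityʳ y))) (proj₁ y-order)

  xx : ∀ a → x ∙ (x ∙ a) ≡ a
  xx = involution-cancel x∙x≡ε

  yyy : ∀ a → y ∙ (y ∙ (y ∙ a)) ≡ a
  yyy a = begin
    y ∙ (y ∙ (y ∙ a))   ≡⟨ solve monoid ⟩
    (y ∙ (y ∙ y)) ∙ a   ≡⟨ cong (_∙ a) y∙[y∙y]≡ε ⟩
    ε ∙ a               ≡⟨ identityˡ a ⟩
    a                   ∎

  x≢ε : x ≢ ε
  x≢ε e = proj₂ x-order 1 z<s (s≤s (s≤s z≤n)) (trans (identityʳ x) e)

  y≢ε : y ≢ ε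
  y≢ε e = proj₂ y-order 1 z<s (s≤s (s≤s z≤n)) (trans (identityʳ y) e)

  y∙y≢ε : y ∙ y ≢ ε
  y∙y≢ε e = proj₂ y-order 2 z<s (s≤s (s≤s (s≤s z≤n))) (trans (cong (y ∙_) (identityʳ y)) e)

  x≢y : x ≢ y
  x≢y e = y∙y≢ε (trans (cong₂ _∙_ (sym e) (sym e)) x∙x≡ε)

  module Commuting (xy≡yx : x ∙ y ≡ y ∙ x) where

    [xy]²≡y² : pow G (x ∙ y) 2 ≡ y ∙ y
    [xy]²≡y² = begin
      (x ∙ y) ∙ ((x ∙ y) ∙ ε)   ≡⟨ solve monoid ⟩
      x ∙ ((y ∙ x) ∙ y)         ≡⟨ cong (λ a → x ∙ (a ∙ y)) (sym xy≡yx) ⟩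
      x ∙ ((x ∙ y) ∙ y)         ≡⟨ solve monoid ⟩
      x ∙ (x ∙ (y ∙ y))         ≡⟨ xx (y ∙ y) ⟩
      y ∙ y                     ∎

    [xy]³≡x : pow G (x ∙ y) 3 ≡ x
    [xy]³≡x = begin
      (x ∙ y) ∙ pow G (x ∙ y) 2   ≡⟨ cong ((x ∙ y) ∙_) [xy]²≡y² ⟩
      (x ∙ y) ∙ (y ∙ y)           ≡⟨ assoc x y _ ⟩
      x ∙ (y ∙ (y ∙ y))           ≡⟨ cong (x ∙_) y∙[y∙y]≡ε ⟩
      x ∙ ε                       ≡⟨ identityʳ x ⟩
      x                           ∎

    [xy]⁴≡y : pow G (x ∙ y) 4 ≡ y
    [xy]⁴≡y = begin
      (x ∙ y) ∙ pow G (x ∙ y) 3   ≡⟨ cong ((x ∙ y) ∙_) [xy]³≡x ⟩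
      (x ∙ y) ∙ x                 ≡⟨ cong (_∙ x) xy≡yx ⟩
      (y ∙ x) ∙ x                 ≡⟨ assoc y x x ⟩
      y ∙ (x ∙ x)                 ≡⟨ cong (y ∙_) x∙x≡ε ⟩
      y ∙ ε                       ≡⟨ identityʳ y ⟩
      y                           ∎

    [xy]⁶≡ε : pow G (x ∙ y) 6 ≡ ε
    [xy]⁶≡ε = trans (pow-+ (x ∙ y) 3 3) (trans (cong₂ _∙_ [xy]³≡x [xy]³≡x) x∙x≡ε)

    -- A smaller d with (xy)ᵈ = ε would kill x = (xy)³ or y = (xy)⁴.
    xy-order : HasOrder G (x ∙ y) 6
    xy-order = [xy]⁶≡ε , power≢ε
      where
      power≢ε : ∀ d → 0 < d → d < 6 → pow G (x ∙ y) d ≢ ε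
      power≢ε 1 _ _ e = x≢ε (trans (sym [xy]³≡x) (pow-*-ε {d = 1} e 3))
      power≢ε 2 _ _ e = y≢ε (trans (sym [xy]⁴≡y) (pow-*-ε {d = 2} e 2))
      power≢ε 3 _ _ e = x≢ε (trans (sym [xy]³≡x) e)
      power≢ε 4 _ _ e = y≢ε (trans (sym [xy]⁴≡y) e)
      power≢ε 5 _ _ e = power≢ε 1 z<s (s≤s (s≤s z≤n)) (begin
        pow G (x ∙ y) 1                       ≡⟨ sym (identityʳ _) ⟩
        pow G (x ∙ y) 1 ∙ ε                   ≡⟨ cong (pow G (x ∙ y) 1 ∙_) (sym e) ⟩
        pow G (x ∙ y) 1 ∙ pow G (x ∙ y) 5     ≡⟨ sym (pow-+ (x ∙ y) 1 5) ⟩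
        pow G (x ∙ y) 6                       ≡⟨ [xy]⁶≡ε ⟩
        ε                                     ∎)
      power≢ε (suc (suc (suc (suc (suc (suc _)))))) _ (s≤s (s≤s (s≤s (s≤s (s≤s (s≤s ()))))))

    ≅Z6 : IsoTo G Z6 Z6-mul
    ≅Z6 = cyclic-IsoTo (powers-generate gen (# 3 , [xy]³≡x) (# 4 , [xy]⁴≡y))
      where open Cyclic G (x ∙ y) 6 xy-order

  xs : Fin 2 → Fin n
  xs Fin.zero    = ε
  xs (Fin.suc _) = x

  xs∙xs≡ε : ∀ s → xs s ∙ xs s ≡ ε
  xs∙xs≡ε Fin.zero    = identityˡ ε
  xs∙xs≡ε (Fin.suc _) = x∙x≡ε

  xs-+ : ∀ s t → xs (addMod 2 s t) ≡ xs t ∙ xs s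
  xs-+ Fin.zero           Fin.zero           = sym (identityˡ ε)
  xs-+ Fin.zero           (Fin.suc Fin.zero) = sym (identityʳ x)
  xs-+ (Fin.suc Fin.zero) Fin.zero           = sym (identityˡ x)
  xs-+ (Fin.suc Fin.zero) (Fin.suc Fin.zero) = sym x∙x≡ε

  module NonCommuting (xy≢yx : x ∙ y ≢ y ∙ x) where

    z : Fin n
    z = x ∙ (y ∙ x)

    S : Subset n
    S = ⁅ x ⁆ ∪ (⁅ y ⁆ ∪ ⁅ z ⁆)

    data InS (g : Fin n) : Set where
      ≡x : g ≡ x → InS g
      ≡y : g ≡ y → InS g
      ≡z : g ≡ z → InS g

    ∈S⇒InS : ∀ {g} → g ∈ S → InS g
    ∈S⇒InS g∈S with x∈p∪q⁻ ⁅ x ⁆ _ g∈S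
    ... | inj₁ g∈x = ≡x (x∈⁅y⁆⇒x≡y x g∈x)
    ... | inj₂ g∈yz with x∈p∪q⁻ ⁅ y ⁆ ⁅ z ⁆ g∈yz
    ...   | inj₁ g∈y = ≡y (x∈⁅y⁆⇒x≡y y g∈y)
    ...   | inj₂ g∈z = ≡z (x∈⁅y⁆⇒x≡y z g∈z)

    InS⇒∈S : ∀ {g} → InS g → g ∈ S
    InS⇒∈S (≡x refl) = x∈p∪q⁺ (inj₁ (x∈⁅x⁆ x))
    InS⇒∈S (≡y refl) = x∈p∪q⁺ (inj₂ (x∈p∪q⁺ (inj₁ (x∈⁅x⁆ y))))
    InS⇒∈S (≡z refl) = x∈p∪q⁺ (inj₂ (x∈p∪q⁺ (inj₂ (x∈⁅x⁆ z))))

    xz≡yx : ∀ a → x ∙ (z ∙ a) ≡ y ∙ (x ∙ a)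
    xz≡yx a = begin
      x ∙ (z ∙ a)               ≡⟨ solve monoid ⟩
      x ∙ (x ∙ (y ∙ (x ∙ a)))   ≡⟨ xx _ ⟩
      y ∙ (x ∙ a)               ∎

    zx≡xy : ∀ a → z ∙ (x ∙ a) ≡ x ∙ (y ∙ a)
    zx≡xy a = begin
      z ∙ (x ∙ a)               ≡⟨ solve monoid ⟩
      x ∙ (y ∙ (x ∙ (x ∙ a)))   ≡⟨ cong (λ b → x ∙ (y ∙ b)) (xx a) ⟩
      x ∙ (y ∙ a)               ∎

    zzz : ∀ a → z ∙ (z ∙ (z ∙ a)) ≡ a
    zzz a = begin
      z ∙ (z ∙ (z ∙ a))               ≡⟨ solve monoid ⟩
      x ∙ (y ∙ (x ∙ (z ∙ (z ∙ a))))   ≡⟨ cong (λ b → x ∙ (y ∙ b)) (xz≡yx _) ⟩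
      x ∙ (y ∙ (y ∙ (x ∙ (z ∙ a))))   ≡⟨ cong (λ b → x ∙ (y ∙ (y ∙ b))) (xz≡yx a) ⟩
      x ∙ (y ∙ (y ∙ (y ∙ (x ∙ a))))   ≡⟨ cong (x ∙_) (yyy _) ⟩
      x ∙ (x ∙ a)                     ≡⟨ xx a ⟩
      a                               ∎

    x∙z∙x≡y : (x ∙ z) ∙ x ≡ y
    x∙z∙x≡y = begin
      (x ∙ z) ∙ x               ≡⟨ solve monoid ⟩
      x ∙ (x ∙ (y ∙ (x ∙ x)))   ≡⟨ xx _ ⟩
      y ∙ (x ∙ x)               ≡⟨ cong (y ∙_) x∙x≡ε ⟩
      y ∙ ε                     ≡⟨ identityʳ y ⟩
      y                         ∎

    z∙[z∙z]≡ε : z ∙ (z ∙ z) ≡ ε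
    z∙[z∙z]≡ε = trans (cong (λ a → z ∙ (z ∙ a)) (sym (identityʳ z))) (zzz ε)

    ∙x≡ε⇒≡x : ∀ {a} → a ∙ x ≡ ε → a ≡ x
    ∙x≡ε⇒≡x {a} e = trans (inverseˡ-unique a x e) (involution-⁻¹ x∙x≡ε)

    y≢z : y ≢ z
    y≢z e = xy≢yx (begin
      x ∙ y                   ≡⟨ cong (x ∙_) e ⟩
      x ∙ (x ∙ (y ∙ x))       ≡⟨ xx _ ⟩
      y ∙ x                   ∎)

    z≢ε : z ≢ ε
    z≢ε e = y≢ε (begin
      y             ≡⟨ sym x∙z∙x≡y ⟩
      (x ∙ z) ∙ x   ≡⟨ cong (λ a → (x ∙ a) ∙ x) e ⟩
      (x ∙ ε) ∙ x   ≡⟨ cong (_∙ x) (identityʳ x) ⟩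
      x ∙ x         ≡⟨ x∙x≡ε ⟩
      ε             ∎)

    x≢z : x ≢ z
    x≢z e = x≢y (begin
      x             ≡⟨ sym (trans (cong (_∙ x) x∙x≡ε) (identityˡ x)) ⟩
      (x ∙ x) ∙ x   ≡⟨ cong (λ a → (x ∙ a) ∙ x) e ⟩
      (x ∙ z) ∙ x   ≡⟨ x∙z∙x≡y ⟩
      y             ∎)

    y∙[x∙y]≢ε : y ∙ (x ∙ y) ≢ ε
    y∙[x∙y]≢ε e = x≢y (∙-cancelʳ y x y (∙-cancelˡ y _ _ (trans e (sym y∙[y∙y]≡ε))))

    y∙y≢x : y ∙ y ≢ x
    y∙y≢x e = y≢ε (begin
      y                     ≡⟨ sym (yyy y) ⟩
      y ∙ (y ∙ (y ∙ y))     ≡⟨ solve monoid ⟩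
      (y ∙ y) ∙ (y ∙ y)     ≡⟨ cong₂ _∙_ e e ⟩
      x ∙ x                 ≡⟨ x∙x≡ε ⟩
      ε                     ∎)

    conjx-InS : ∀ {g} → InS g → InS ((x ∙ g) ∙ x)
    conjx-InS (≡x refl) = ≡x (trans (cong (_∙ x) x∙x≡ε) (identityˡ x))
    conjx-InS (≡y refl) = ≡z (assoc x y x)
    conjx-InS (≡z refl) = ≡y x∙z∙x≡y

    ∙≢x : ∀ {t s} → InS t → InS s → t ∙ s ≢ x
    ∙≢x (≡x refl) (≡x refl) e = x≢ε (trans (sym e) x∙x≡ε)
    ∙≢x (≡x refl) (≡y refl) e = y≢ε (∙-cancelˡ x y ε (trans e (sym (identityʳ x))))
    ∙≢x (≡x refl) (≡z refl) e = z≢ε (∙-cancelˡ x z ε (trans e (sym (identityʳ x))))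
    ∙≢x (≡y refl) (≡x refl) e = y≢ε (identityˡ-unique y x e)
    ∙≢x (≡y refl) (≡y refl) e = y∙y≢x e
    ∙≢x (≡y refl) (≡z refl) e = y∙[x∙y]≢ε (identityˡ-unique _ x (begin
      (y ∙ (x ∙ y)) ∙ x   ≡⟨ solve monoid ⟩
      y ∙ z               ≡⟨ e ⟩
      x                   ∎))
    ∙≢x (≡z refl) (≡x refl) e = z≢ε (identityˡ-unique z x e)
    ∙≢x (≡z refl) (≡y refl) e = y∙[x∙y]≢ε (∙-cancelˡ x _ ε (begin
      x ∙ (y ∙ (x ∙ y))   ≡⟨ solve monoid ⟩
      z ∙ y               ≡⟨ e ⟩
      x                   ≡⟨ sym (identityʳ x) ⟩
      x ∙ ε               ∎))
    ∙≢x (≡z refl) (≡z refl) e = y∙y≢x (∙x≡ε⇒≡x (∙-cancelˡ x _ ε (begin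
      x ∙ ((y ∙ y) ∙ x)             ≡⟨ solve monoid ⟩
      x ∙ (y ∙ (y ∙ x))             ≡⟨ cong (λ a → x ∙ (y ∙ a)) (sym (xx (y ∙ x))) ⟩
      x ∙ (y ∙ (x ∙ (x ∙ (y ∙ x)))) ≡⟨ solve monoid ⟩
      z ∙ z                         ≡⟨ e ⟩
      x                             ≡⟨ sym (identityʳ x) ⟩
      x ∙ ε                         ∎)))

    ∙zy≢ε : ∀ {s} → InS s → s ∙ (z ∙ y) ≢ ε
    ∙zy≢ε (≡x refl) e = y∙[x∙y]≢ε (trans (sym (xz≡yx y)) e)
    ∙zy≢ε (≡y refl) e = y≢z (sym (∙-cancelʳ y z y (∙-cancelˡ y _ _ (trans e (sym y∙[y∙y]≡ε)))))
    ∙zy≢ε (≡z refl) e = y≢z (∙-cancelˡ z y z (∙-cancelˡ z _ _ (trans e (sym z∙[z∙z]≡ε))))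

    ε∉S : ε ∉ S
    ε∉S ε∈S with ∈S⇒InS ε∈S
    ... | ≡x e = x≢ε (sym e)
    ... | ≡y e = y≢ε (sym e)
    ... | ≡z e = z≢ε (sym e)

    infix 4 _⟶_
    _⟶_ : Fin n → Fin n → Set
    u ⟶ v = ∃ λ s → InS s × v ≡ s ∙ u

    Arc⇒⟶ : ∀ {u v} → Arc G S u v → u ⟶ v
    Arc⇒⟶ {u} {v} arc = v ∙ u ⁻¹ , ∈S⇒InS arc , sym ([a∙b⁻¹]∙b≡a v u)

    ⟶⇒Arc : ∀ {u v} → u ⟶ v → Arc G S u v
    ⟶⇒Arc {u} (s , s∈ , refl) = subst (_∈ S) (sym ([a∙b]∙b⁻¹≡a s u)) (InS⇒∈S s∈)

    x-arc-in-no-triangle : ∀ {u w} → x ∙ u ⟶ w → w ⟶ u → ⊥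
    x-arc-in-no-triangle {u} (t , t∈ , refl) (r , r∈ , eu) =
      ∙≢x r∈ t∈ (∙x≡ε⇒≡x (identityˡ-unique _ u (begin
        ((r ∙ t) ∙ x) ∙ u   ≡⟨ solve monoid ⟩
        r ∙ (t ∙ (x ∙ u))   ≡⟨ sym eu ⟩
        u                   ∎)))

    module Stabiliser (π : Permutation′ n) (π-aut : IsAut G S π) (π-fix : π ⟨$⟩ʳ ε ≡ ε) where

      φ : Fin n → Fin n
      φ u = π ⟨$⟩ʳ u

      φ-⟶ : ∀ {u v} → u ⟶ v → φ u ⟶ φ v
      φ-⟶ {u} {v} e = Arc⇒⟶ (proj₁ (π-aut u v) (⟶⇒Arc e))

      φ-⟶⁻ : ∀ {u v} → φ u ⟶ φ v → u ⟶ v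
      φ-⟶⁻ {u} {v} e = Arc⇒⟶ (proj₂ (π-aut u v) (⟶⇒Arc e))

      φ-injective : ∀ {u v} → φ u ≡ φ v → u ≡ v
      φ-injective e = trans (sym (Permutation.inverseˡ π)) (trans (cong (π ⟨$⟩ˡ_) e) (Permutation.inverseˡ π))

      φ-cancelʳ : ∀ {a b} u → φ (a ∙ u) ≡ φ (b ∙ u) → a ≡ b
      φ-cancelʳ u e = ∙-cancelʳ u _ _ (φ-injective e)

      x-arc↛triangle-arc : ∀ {s} u → InS s → (∀ a → s ∙ (s ∙ (s ∙ a)) ≡ a) → φ (x ∙ u) ≢ s ∙ φ u
      x-arc↛triangle-arc {s} u s∈ sss e = x-arc-in-no-triangle
        (φ-⟶⁻ (s , s∈ , trans φw (cong (s ∙_) (sym e))))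
        (φ-⟶⁻ (s , s∈ , trans (sym (sss (φ u))) (cong (s ∙_) (sym φw))))
        where
        w : Fin n
        w = π ⟨$⟩ˡ (s ∙ (s ∙ φ u))
        φw : φ w ≡ s ∙ (s ∙ φ u)
        φw = Permutation.inverseʳ π

      -- Every y- and z-arc lies on a directed triangle (y³ = z³ = ε) but no
      -- x-arc does, so φ maps x-arcs to x-arcs.
      φ-x : ∀ u → φ (x ∙ u) ≡ x ∙ φ u
      φ-x u with φ-⟶ {u} (x , ≡x refl , refl)
      ... | _ , ≡x refl , e = e
      ... | _ , ≡y refl , e = ⊥-elim (x-arc↛triangle-arc u (≡y refl) yyy e)
      ... | _ , ≡z refl , e = ⊥-elim (x-arc↛triangle-arc u (≡z refl) zzz e)

      PreservesYZ SwapsYZ : Fin n → Set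
      PreservesYZ u = φ (y ∙ u) ≡ y ∙ φ u × φ (z ∙ u) ≡ z ∙ φ u
      SwapsYZ     u = φ (y ∙ u) ≡ z ∙ φ u × φ (z ∙ u) ≡ y ∙ φ u

      ¬preserves×swaps : ∀ {u} → PreservesYZ u → SwapsYZ u → ⊥
      ¬preserves×swaps (e , _) (e′ , _) = y≢z (∙-cancelʳ _ y z (trans (sym e) e′))

      φ-yz : ∀ {s} u → InS s → s ≢ x → φ (s ∙ u) ≡ y ∙ φ u ⊎ φ (s ∙ u) ≡ z ∙ φ u
      φ-yz u s∈ s≢x with φ-⟶ {u} (_ , s∈ , refl)
      ... | _ , ≡x refl , e = ⊥-elim (s≢x (φ-cancelʳ u (trans e (sym (φ-x u)))))
      ... | _ , ≡y refl , e = inj₁ e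
      ... | _ , ≡z refl , e = inj₂ e

      preserves⊎swaps : ∀ u → PreservesYZ u ⊎ SwapsYZ u
      preserves⊎swaps u with φ-yz u (≡y refl) (x≢y ∘ sym) | φ-yz u (≡z refl) (x≢z ∘ sym)
      ... | inj₁ e | inj₂ e′ = inj₁ (e , e′)
      ... | inj₂ e | inj₁ e′ = inj₂ (e , e′)
      ... | inj₁ e | inj₁ e′ = ⊥-elim (y≢z (φ-cancelʳ u (trans e (sym e′))))
      ... | inj₂ e | inj₂ e′ = ⊥-elim (y≢z (φ-cancelʳ u (trans e (sym e′))))

      preserves-x : ∀ {u} → PreservesYZ u → PreservesYZ (x ∙ u)
      preserves-x {u} (e , e′) =
        (begin
          φ (y ∙ (x ∙ u))   ≡⟨ cong φ (sym (xz≡yx u)) ⟩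
          φ (x ∙ (z ∙ u))   ≡⟨ φ-x _ ⟩
          x ∙ φ (z ∙ u)     ≡⟨ cong (x ∙_) e′ ⟩
          x ∙ (z ∙ φ u)     ≡⟨ xz≡yx _ ⟩
          y ∙ (x ∙ φ u)     ≡⟨ cong (y ∙_) (sym (φ-x u)) ⟩
          y ∙ φ (x ∙ u)     ∎) ,
        (begin
          φ (z ∙ (x ∙ u))   ≡⟨ cong φ (zx≡xy u) ⟩
          φ (x ∙ (y ∙ u))   ≡⟨ φ-x _ ⟩
          x ∙ φ (y ∙ u)     ≡⟨ cong (x ∙_) e ⟩
          x ∙ (y ∙ φ u)     ≡⟨ sym (zx≡xy _) ⟩
          z ∙ (x ∙ φ u)     ≡⟨ cong (z ∙_) (sym (φ-x u)) ⟩
          z ∙ φ (x ∙ u)     ∎)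

      back-arc : ∀ u → ∃ λ s → InS s × φ u ≡ s ∙ φ (y ∙ (y ∙ u))
      back-arc u = φ-⟶ {y ∙ (y ∙ u)} (y , ≡y refl , sym (yyy u))

      -- If yu swapped y and z, φ would map the arc y²u → u to an s-arc with s z y = ε.
      preserves-y : ∀ {u} → PreservesYZ u → PreservesYZ (y ∙ u)
      preserves-y {u} (e , _) with preserves⊎swaps (y ∙ u)
      ... | inj₁ p        = p
      ... | inj₂ (f , _) with back-arc u
      ...   | s , s∈ , eu = ⊥-elim (∙zy≢ε s∈ (identityˡ-unique _ (φ u) (sym (begin
        φ u                         ≡⟨ eu ⟩
        s ∙ φ (y ∙ (y ∙ u))         ≡⟨ cong (s ∙_) f ⟩
        s ∙ (z ∙ φ (y ∙ u))         ≡⟨ cong (λ a → s ∙ (z ∙ a)) e ⟩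
        s ∙ (z ∙ (y ∙ φ u))         ≡⟨ solve monoid ⟩
        (s ∙ (z ∙ y)) ∙ φ u         ∎))))

      preserves-constant : ∀ g → (PreservesYZ ε → PreservesYZ g) × (PreservesYZ g → PreservesYZ ε)
      preserves-constant = leftInvariant⇒constant gen PreservesYZ
        (λ u → preserves-x , subst PreservesYZ (xx u) ∘ preserves-x)
        (λ u → preserves-y , subst PreservesYZ (yyy u) ∘ preserves-y ∘ preserves-y)

      φ≡id : (∀ u → PreservesYZ u) → ∀ u → φ u ≡ u
      φ≡id preserves u = begin
        φ u       ≡⟨ commutesWithGenerators⇒rightTranslation gen φ φ-x (proj₁ ∘ preserves) u ⟩
        u ∙ φ ε   ≡⟨ cong (u ∙_) π-fix ⟩
        u ∙ ε     ≡⟨ identityʳ u ⟩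
        u         ∎

      φ≡conjx : (∀ u → SwapsYZ u) → ∀ u → φ u ≡ (x ∙ u) ∙ x
      φ≡conjx swaps u = begin
        φ u             ≡⟨ sym (involution-conj-involutive x∙x≡ε (φ u)) ⟩
        (x ∙ ψ u) ∙ x   ≡⟨ cong (λ a → (x ∙ a) ∙ x) ψ≡id ⟩
        (x ∙ u) ∙ x     ∎
        where
        ψ : Fin n → Fin n
        ψ v = (x ∙ φ v) ∙ x
        ψ-x : ∀ v → ψ (x ∙ v) ≡ x ∙ ψ v
        ψ-x v = trans (cong (λ a → (x ∙ a) ∙ x) (φ-x v)) (assoc x _ x)
        ψ-y : ∀ v → ψ (y ∙ v) ≡ y ∙ ψ v
        ψ-y v = begin
          (x ∙ φ (y ∙ v)) ∙ x   ≡⟨ cong (λ a → (x ∙ a) ∙ x) (proj₁ (swaps v)) ⟩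
          (x ∙ (z ∙ φ v)) ∙ x   ≡⟨ cong (_∙ x) (xz≡yx _) ⟩
          (y ∙ (x ∙ φ v)) ∙ x   ≡⟨ assoc y _ x ⟩
          y ∙ ψ v               ∎
        ψ≡id : ψ u ≡ u
        ψ≡id = begin
          ψ u                   ≡⟨ commutesWithGenerators⇒rightTranslation gen ψ ψ-x ψ-y u ⟩
          u ∙ ((x ∙ φ ε) ∙ x)   ≡⟨ cong (λ a → u ∙ ((x ∙ a) ∙ x)) π-fix ⟩
          u ∙ ((x ∙ ε) ∙ x)     ≡⟨ cong (λ a → u ∙ (a ∙ x)) (identityʳ x) ⟩
          u ∙ (x ∙ x)           ≡⟨ cong (u ∙_) x∙x≡ε ⟩
          u ∙ ε                 ≡⟨ identityʳ u ⟩
          u                     ∎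

      classification : (∀ u → φ u ≡ u) ⊎ (∀ u → φ u ≡ (x ∙ u) ∙ x)
      classification with preserves⊎swaps ε
      ... | inj₁ p = inj₁ (φ≡id (λ g → proj₁ (preserves-constant g) p))
      ... | inj₂ q = inj₂ (φ≡conjx swaps)
        where
        swaps : ∀ g → SwapsYZ g
        swaps g with preserves⊎swaps g
        ... | inj₁ p  = ⊥-elim (¬preserves×swaps (proj₂ (preserves-constant g) p) q)
        ... | inj₂ q′ = q′

    conj-xs-S : ∀ s {g} → g ∈ S → (xs s ∙ g) ∙ xs s ∈ S
    conj-xs-S Fin.zero    {g} g∈S = subst (_∈ S) (sym (trans (identityʳ _) (identityˡ g))) g∈S
    conj-xs-S (Fin.suc _)     g∈S = InS⇒∈S (conjx-InS (∈S⇒InS g∈S))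

    automorphism : Fin 2 × Fin n → Permutation′ n
    automorphism (s , k) = translation (xs s) k

    automorphism-isAut : ∀ p → IsAut G S (automorphism p)
    automorphism-isAut (s , k) = involution-translation-isAut G S k (xs∙xs≡ε s) (conj-xs-S s)

    x-translation≢right-translation : ∀ k l → ¬ (∀ u → u ∙ k ≡ (x ∙ u) ∙ l)
    x-translation≢right-translation k l e = xy≢yx (∙-cancelʳ l _ _ (begin
      (x ∙ y) ∙ l   ≡⟨ sym (e y) ⟩
      y ∙ k         ≡⟨ cong (y ∙_) k≡xl ⟩
      y ∙ (x ∙ l)   ≡⟨ sym (assoc y x l) ⟩
      (y ∙ x) ∙ l   ∎))
      where
      k≡xl : k ≡ x ∙ l
      k≡xl = trans (sym (identityˡ k)) (trans (e ε) (cong (_∙ l) (identityʳ x)))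

    automorphism-injective : ∀ p q → (∀ u → automorphism p ⟨$⟩ʳ u ≡ automorphism q ⟨$⟩ʳ u) → p ≡ q
    automorphism-injective (Fin.zero , k) (Fin.zero , l) e =
      cong (Fin.zero ,_) (∙-cancelˡ (ε ∙ ε) k l (e ε))
    automorphism-injective (Fin.suc Fin.zero , k) (Fin.suc Fin.zero , l) e =
      cong (Fin.suc Fin.zero ,_) (∙-cancelˡ (x ∙ ε) k l (e ε))
    automorphism-injective (Fin.zero , k) (Fin.suc Fin.zero , l) e = ⊥-elim
      (x-translation≢right-translation k l (λ u → trans (cong (_∙ k) (sym (identityˡ u))) (e u)))
    automorphism-injective (Fin.suc Fin.zero , k) (Fin.zero , l) e = ⊥-elim
      (x-translation≢right-translation l k (λ u → trans (cong (_∙ l) (sym (identityˡ u))) (sym (e u))))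

    automorphisms : Fin (2 * n) → Permutation′ n
    automorphisms i = automorphism (Fin.remQuot {2} n i)

    automorphisms-at : ∀ s k u → automorphisms (Fin.combine {2} s k) ⟨$⟩ʳ u ≡ (xs s ∙ u) ∙ k
    automorphisms-at s k u = cong (λ p → automorphism p ⟨$⟩ʳ u) (remQuot-combine {2} {n} s k)

    automorphisms-injective : ∀ i j → (∀ u → automorphisms i ⟨$⟩ʳ u ≡ automorphisms j ⟨$⟩ʳ u) → i ≡ j
    automorphisms-injective i j e = begin
      i                                         ≡⟨ sym (combine-remQuot {2} n i) ⟩
      uncurry Fin.combine (Fin.remQuot {2} n i) ≡⟨ cong (uncurry Fin.combine)
                                                     (automorphism-injective (Fin.remQuot n i) (Fin.remQuot n j) e) ⟩
      uncurry Fin.combine (Fin.remQuot {2} n j) ≡⟨ combine-remQuot {2} n j ⟩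
      j                                         ∎

    automorphisms-complete : ∀ π → IsAut G S π → ∃ λ i → ∀ u → π ⟨$⟩ʳ u ≡ automorphisms i ⟨$⟩ʳ u
    automorphisms-complete π π-aut =
      from-classification (Stabiliser.classification π₀ π₀-aut π₀-fix)
      where
      k : Fin n
      k = π ⟨$⟩ʳ ε
      π₀ : Permutation′ n
      π₀ = π ∘ₚ translation ε (k ⁻¹)
      π₀-aut : IsAut G S π₀
      π₀-aut = IsAut-∘ₚ G S {π} {translation ε (k ⁻¹)} π-aut (automorphism-isAut (Fin.zero , k ⁻¹))
      π₀-fix : π₀ ⟨$⟩ʳ ε ≡ ε
      π₀-fix = trans (cong (_∙ k ⁻¹) (identityˡ k)) (inverseʳ k)
      π≡π₀∙k : ∀ u → π ⟨$⟩ʳ u ≡ (π₀ ⟨$⟩ʳ u) ∙ k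
      π≡π₀∙k u = sym (trans ([a∙b⁻¹]∙b≡a _ k) (identityˡ _))
      from-classification : (∀ u → π₀ ⟨$⟩ʳ u ≡ u) ⊎ (∀ u → π₀ ⟨$⟩ʳ u ≡ (x ∙ u) ∙ x) →
        ∃ λ i → ∀ u → π ⟨$⟩ʳ u ≡ automorphisms i ⟨$⟩ʳ u
      from-classification (inj₁ fixes) = Fin.combine {2} Fin.zero k , λ u → begin
        π ⟨$⟩ʳ u                                ≡⟨ π≡π₀∙k u ⟩
        (π₀ ⟨$⟩ʳ u) ∙ k                         ≡⟨ cong (_∙ k) (trans (fixes u) (sym (identityˡ u))) ⟩
        (ε ∙ u) ∙ k                             ≡⟨ sym (automorphisms-at Fin.zero k u) ⟩
        automorphisms (Fin.combine {2} Fin.zero k) ⟨$⟩ʳ u   ∎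
      from-classification (inj₂ conjugates) = Fin.combine {2} (Fin.suc Fin.zero) (x ∙ k) , λ u → begin
        π ⟨$⟩ʳ u                                ≡⟨ π≡π₀∙k u ⟩
        (π₀ ⟨$⟩ʳ u) ∙ k                         ≡⟨ cong (_∙ k) (conjugates u) ⟩
        ((x ∙ u) ∙ x) ∙ k                       ≡⟨ assoc _ x k ⟩
        (x ∙ u) ∙ (x ∙ k)                       ≡⟨ sym (automorphisms-at (Fin.suc Fin.zero) (x ∙ k) u) ⟩
        automorphisms (Fin.combine {2} (Fin.suc Fin.zero) (x ∙ k)) ⟨$⟩ʳ u   ∎

    cayleyIndex : CayleyIndex G S 2
    cayleyIndex = automorphisms , (λ i → automorphism-isAut (Fin.remQuot n i)) , automorphisms-injective , automorphisms-complete

    module Regular (H : Subset n) (sg : IsSubgroup G H) (index : HasIndex G H 2) where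
      open IsSubgroup sg
      open IndexTwo G H sg index

      x∉H : x ∉ H
      x∉H = generator∉ gen (cube≡ε⇒∈ y∙[y∙y]≡ε)

      ρ : HZ2 G H → Permutation′ n
      ρ ((h , _) , s) = translation (xs s) h

      ρ-hom : ∀ a b u → ρ (HZ2-mul G H sg a b) ⟨$⟩ʳ u ≡ ρ b ⟨$⟩ʳ (ρ a ⟨$⟩ʳ u)
      ρ-hom ((h , _) , s) ((k , _) , t) u = begin
        (xs (addMod 2 s t) ∙ u) ∙ (h ∙ k)   ≡⟨ cong (λ c → (c ∙ u) ∙ (h ∙ k)) (xs-+ s t) ⟩
        ((xs t ∙ xs s) ∙ u) ∙ (h ∙ k)       ≡⟨ solve monoid ⟩
        (xs t ∙ ((xs s ∙ u) ∙ h)) ∙ k       ∎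

      ρ-isAut : ∀ a → IsAut G S (ρ a)
      ρ-isAut ((h , _) , s) = automorphism-isAut (s , h)

      -- If u⁻¹v ∉ H then u⁻¹xv = (u⁻¹v)(v⁻¹xv) is a product of two elements
      -- outside the normal subgroup H.
      ρ-transitive : ∀ u v → ∃ λ a → ρ a ⟨$⟩ʳ u ≡ v
      ρ-transitive u v with (u ⁻¹ ∙ v) ∈? H
      ... | yes u⁻¹v∈ = ((u ⁻¹ ∙ v , u⁻¹v∈) , Fin.zero) ,
        trans (cong (_∙ (u ⁻¹ ∙ v)) (identityˡ u)) (a∙[a⁻¹∙b]≡b u v)
      ... | no u⁻¹v∉  = ((u ⁻¹ ∙ (x ∙ v) , u⁻¹xv∈) , Fin.suc Fin.zero) , (begin
        (x ∙ u) ∙ (u ⁻¹ ∙ (x ∙ v))   ≡⟨ assoc x u _ ⟩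
        x ∙ (u ∙ (u ⁻¹ ∙ (x ∙ v)))   ≡⟨ cong (x ∙_) (a∙[a⁻¹∙b]≡b u _) ⟩
        x ∙ (x ∙ v)                  ≡⟨ xx v ⟩
        v                            ∎)
        where
        v⁻¹xv∉ : v ⁻¹ ∙ (x ∙ v) ∉ H
        v⁻¹xv∉ v⁻¹xv∈ = x∉H (subst (_∈ H) (begin
          (v ∙ (v ⁻¹ ∙ (x ∙ v))) ∙ v ⁻¹   ≡⟨ cong (_∙ v ⁻¹) (a∙[a⁻¹∙b]≡b v _) ⟩
          (x ∙ v) ∙ v ⁻¹                  ≡⟨ [a∙b]∙b⁻¹≡a x v ⟩
          x                               ∎) (conj-∈ v v⁻¹xv∈))
        u⁻¹xv∈ : u ⁻¹ ∙ (x ∙ v) ∈ H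
        u⁻¹xv∈ = subst (_∈ H) (begin
          (u ⁻¹ ∙ v) ∙ (v ⁻¹ ∙ (x ∙ v))   ≡⟨ assoc _ v _ ⟩
          u ⁻¹ ∙ (v ∙ (v ⁻¹ ∙ (x ∙ v)))   ≡⟨ cong (u ⁻¹ ∙_) (a∙[a⁻¹∙b]≡b v _) ⟩
          u ⁻¹ ∙ (x ∙ v)                  ∎) (∉∙∉⇒∈ u⁻¹v∉ v⁻¹xv∉)

      HZ2-≡ : ∀ {h k} {h∈ : h ∈ H} {k∈ : k ∈ H} {s} → h ≡ k → _≡_ {A = HZ2 G H} ((h , h∈) , s) ((k , k∈) , s)
      HZ2-≡ {h∈ = h∈} {k∈} refl = cong (λ p → (_ , p) , _) ([]=-irrelevant h∈ k∈)

      -- Here x = u (h k⁻¹) u⁻¹ would lie in H.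
      ¬ε-translation≡x-translation : ∀ {h k} u → h ∈ H → k ∈ H → (ε ∙ u) ∙ h ≢ (x ∙ u) ∙ k
      ¬ε-translation≡x-translation {h} {k} u h∈ k∈ e = x∉H (subst (_∈ H) (sym (begin
        x                                 ≡⟨ sym ([a∙b]∙b⁻¹≡a x u) ⟩
        (x ∙ u) ∙ u ⁻¹                    ≡⟨ cong (_∙ u ⁻¹) (sym ([a∙b]∙b⁻¹≡a (x ∙ u) k)) ⟩
        (((x ∙ u) ∙ k) ∙ k ⁻¹) ∙ u ⁻¹     ≡⟨ cong (λ a → (a ∙ k ⁻¹) ∙ u ⁻¹) (sym e) ⟩
        (((ε ∙ u) ∙ h) ∙ k ⁻¹) ∙ u ⁻¹     ≡⟨ solve monoid ⟩
        (u ∙ (h ∙ k ⁻¹)) ∙ u ⁻¹           ∎)) (conj-∈ u (∙∈ h∈ (⁻¹∈ k∈))))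

      ρ-semiregular : ∀ a b u → ρ a ⟨$⟩ʳ u ≡ ρ b ⟨$⟩ʳ u → a ≡ b
      ρ-semiregular ((h , _) , Fin.zero) ((k , _) , Fin.zero) u e =
        HZ2-≡ (∙-cancelˡ _ h k e)
      ρ-semiregular ((h , _) , Fin.suc Fin.zero) ((k , _) , Fin.suc Fin.zero) u e =
        HZ2-≡ (∙-cancelˡ _ h k e)
      ρ-semiregular ((h , h∈) , Fin.zero) ((k , k∈) , Fin.suc Fin.zero) u e =
        ⊥-elim (¬ε-translation≡x-translation u h∈ k∈ e)
      ρ-semiregular ((h , h∈) , Fin.suc Fin.zero) ((k , k∈) , Fin.zero) u e =
        ⊥-elim (¬ε-translation≡x-translation u k∈ h∈ (sym e))

      ρ-notRightRegular : ¬ ((∀ a → ∃ λ g → ∀ u → ρ a ⟨$⟩ʳ u ≡ u ∙ g)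
                           × (∀ g → ∃ λ a → ∀ u → ρ a ⟨$⟩ʳ u ≡ u ∙ g))
      ρ-notRightRegular (rightTranslation , _) with rightTranslation ((ε , ε∈) , Fin.suc Fin.zero)
      ... | g , e = x-translation≢right-translation g ε (sym ∘ e)

      regular : RegularHZ2 G S H sg
      regular = ρ , ρ-hom , ρ-isAut , ρ-transitive , ρ-semiregular , ρ-notRightRegular

proposition1p2 : {n : ℕ} (G : FinGroup n) (x y : Fin n) →
    HasOrder G x 2 → HasOrder G y 3 → Generates G x y →
    ¬ IsoTo G Z6 Z6-mul → ¬ IsoTo G Z3wrZ2 Z3wrZ2-mul →
    (H : Subset n) (sg : IsSubgroup G H) → HasIndex G H 2 →
    Σ (Subset n) λ S → (FinGroup.ε G ∉ S) × CayleyIndex G S 2 × RegularHZ2 G S H sg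
proposition1p2 G x y x-order y-order gen G≇Z6 _ H sg index =
  S , ε∉S , cayleyIndex , Regular.regular H sg index
  where
  open Generators G x y x-order y-order gen
  xy≢yx : FinGroup._∙_ G x y ≢ FinGroup._∙_ G y x
  xy≢yx xy≡yx = G≇Z6 (Commuting.≅Z6 xy≡yx)
  open NonCommuting xy≢yx
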